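{- Let $r \ge 1$ and $n \ge 3$ be integers, and let $rP_n$ denote the disjoint union of $r$ copies of the path $P_n$ on $n$ vertices. Then $rP_n$ is local antimagic and $$3 \le \chi_{la}(rP_n) \le 2r+2.$$
   Context: All graphs are simple and have no connected component isomorphic to $K_2$. For a graph $G=(V,E)$, a bijection $f:E\to\{1,2,\dots,|E|\}$ induces the weight $w(u)=\sum_{uv\in E} f(uv)$ of each vertex $u$. The bijection $f$ is a local antimagic labeling if $w(u)\neq w(v)$ for every edge $uv$; a graph admitting one is local antimagic. Such a labeling induces a proper vertex coloring by weights. The local antimagic chromatic number $\chi_{la}(G)$ is the minimum number of distinct weights over all local antimagic labelings of $G$. $P_n$ is the path on $n$ vertices. -}

module Defs where

open import Data.Nat using (ℕ; zero; suc; _+_; _*_)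
open import Data.Fin using (Fin; toℕ; inject₁; combine; remQuot)
import Data.Fin as F
open import Data.Product using (_×_; _,_; proj₁; proj₂)
open import Data.List using (List; map; allFin; length; deduplicate)
open import Data.Nat.ListAction using (sum)
open import Data.Bool using (if_then_else_)
open import Relation.Nullary.Decidable using (⌊_⌋)
open import Relation.Binary.PropositionalEquality using (_≡_; _≢_)
open import Function.Definitions using (Bijective)
import Data.Nat as N

record Graph : Set where
  field
    V : ℕ
    E : ℕ
    ends : Fin E → Fin V × Fin V
open Graph public

-- The disjoint union rP_n of r copies of the path P_n.
-- Vertex j (0 ≤ j < n) of copy i is  combine i j : Fin (r * n);
-- edge j (0 ≤ j < n-1) of copy i joins vertices j and j+1 of copy i.
rP : ℕ → ℕ → Graph
rP r zero = record { V = r * zero ; E = 0 ; ends = λ () }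
rP r (suc m) = record
  { V = r * suc m
  ; E = r * m
  ; ends = λ e → let (i , j) = remQuot {r} m e
                 in combine i (inject₁ j) , combine i (F.suc j)
  }

-- An edge labeling: a bijection f : edges → {0,…,|E|-1}; label of e is 1 + f e,
-- so labels range over {1,…,|E|}.
record EdgeLabeling (G : Graph) : Set where
  field
    lab : Fin (E G) → Fin (E G)
    bij : Bijective _≡_ _≡_ lab
open EdgeLabeling public

label : {G : Graph} → EdgeLabeling G → Fin (E G) → ℕ
label f e = suc (toℕ (lab f e))

incident : (G : Graph) → Fin (V G) → Fin (E G) → Data.Bool.Bool
incident G u e = ⌊ proj₁ (ends G e) F.≟ u ⌋ Data.Bool.∨ ⌊ proj₂ (ends G e) F.≟ u ⌋
  where import Data.Bool

weight : (G : Graph) → EdgeLabeling G → Fin (V G) → ℕ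
weight G f u = sum (map (λ e → if incident G u e then label {G} f e else 0) (allFin (E G)))

IsLocalAntimagic : (G : Graph) → EdgeLabeling G → Set
IsLocalAntimagic G f = ∀ e → weight G f (proj₁ (ends G e)) ≢ weight G f (proj₂ (ends G e))

numColors : (G : Graph) → EdgeLabeling G → ℕ
numColors G f = length (deduplicate N._≟_ (map (weight G f) (allFin (V G))))

-- Write l(e) for the label of an edge, and look at one copy of the path with edges
-- e₀, …, e_{n-2}.  An inner vertex has weight l(e_{j-1}) + l(e_j); an end vertex
-- has the single label of its edge.  The weights of the ends of an edge e_j differ
-- by l(e_{j-1}) − l(e_{j+1}) (a missing edge counting as 0), which is nonzero for
-- any bijective labeling as soon as n ≥ 3: so rP_n is local antimagic for every
-- labeling.  The two end weights of a copy are distinct labels, and each is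
-- smaller than the weight of its neighbour; the smaller end, the larger end and
-- the neighbour of the larger end carry three distinct weights.
--
-- For the upper bound, number the N = r(n−1) edges copy after copy and give the
-- k-th one the k-th term of the zigzag 1, N, 2, N−1, 3, …  Two consecutive terms
-- add up to N+1 or N+2, so all inner vertices receive one of these two weights
-- and only the 2r end vertices can contribute further colors.

module Submission where

open import Defs
open import Data.Bool using (if_then_else_)
open import Data.Fin as Fin using (Fin; zero; suc; toℕ; fromℕ; fromℕ<; inject₁; combine; remQuot)
open import Data.Fin.Properties
  using (toℕ<n; toℕ-fromℕ<; toℕ-injective; toℕ-inject₁; toℕ-combine; fromℕ≢inject₁;
         inject₁-injective; combine-injective; combine-injectiveʳ; combine-remQuot; remQuot-combine)
  renaming (suc-injective to suc-injectiveᶠ; 0≢1+n to zero≢suc)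
open import Data.Fin.Relation.Unary.Top using (view; ‵fromℕ; ‵inject₁)
open import Data.List using (List; []; _∷_; _++_; map; allFin; length; filter; deduplicate)
open import Data.List.Membership.Propositional using (_∈_)
open import Data.List.Membership.Propositional.Properties
  using (∈-map⁺; ∈-map⁻; ∈-allFin; ∈-filter⁺; ∈-deduplicate⁺; ∈-deduplicate⁻; ∈-++⁺ˡ; ∈-++⁺ʳ)
open import Data.List.Properties using (map-cong; map-tabulate; length-map; length-++; length-tabulate; filter-notAll)
open import Data.List.Relation.Unary.AllPairs using ([]; _∷_)
open import Data.List.Relation.Unary.All using ([]; _∷_; lookup)
open import Data.List.Relation.Unary.Any using (Any; here; there)
open import Data.List.Relation.Unary.Unique.Propositional using (Unique)
open import Data.List.Relation.Unary.Unique.DecPropositional.Properties using (deduplicate-!)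
open import Data.Nat as ℕ using (ℕ; zero; suc; _+_; _*_; _∸_; _≤_; _<_; s≤s; z≤n; z<s; _<?_; ⌊_/2⌋; parity)
open import Data.Nat.ListAction using (sum)
open import Data.Nat.Properties
open import Algebra.Properties.CommutativeSemigroup +-commutativeSemigroup using (interchange)
open import Data.Parity.Base using (0ℙ; 1ℙ)
open import Data.Product using (Σ; ∃-syntax; _×_; _,_; proj₁; proj₂)
open import Data.Sum as Sum using (_⊎_; inj₁; inj₂)
open import Function.Base using (_∘_; id)
open import Function.Consequences.Propositional
  using (inverseᵇ⇒bijective; strictlyInverseˡ⇒inverseˡ; strictlyInverseʳ⇒inverseʳ)
open import Function.Definitions using (Injective; Bijective)
open import Relation.Binary.Definitions using (DecidableEquality; tri<; tri≈; tri>)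
open import Relation.Binary.PropositionalEquality
open import Relation.Nullary using (¬_; Dec; ¬?; yes; no; contradiction)
open import Relation.Nullary.Decidable using (⌊_⌋)

-- The zigzag permutation  0, N−1, 1, N−2, 2, …  of {0, …, N−1}

even-or-odd : ∀ k → (∃[ a ] k ≡ a + a) ⊎ (∃[ a ] k ≡ suc (a + a))
even-or-odd zero = inj₁ (0 , refl)
even-or-odd (suc k) with even-or-odd k
... | inj₁ (a , refl) = inj₂ (a , refl)
... | inj₂ (a , refl) = inj₁ (suc a , cong suc (sym (+-suc a a)))

parity[n+n]≡0ℙ : ∀ n → parity (n + n) ≡ 0ℙ
parity[n+n]≡0ℙ zero = refl
parity[n+n]≡0ℙ (suc n) rewrite +-suc n n = parity[n+n]≡0ℙ n

parity[1+n+n]≡1ℙ : ∀ n → parity (suc (n + n)) ≡ 1ℙ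
parity[1+n+n]≡1ℙ zero = refl
parity[1+n+n]≡1ℙ (suc n) rewrite +-suc n n = parity[1+n+n]≡1ℙ n

⌊1+n+n/2⌋≡n : ∀ n → ⌊ suc (n + n) /2⌋ ≡ n
⌊1+n+n/2⌋≡n zero = refl
⌊1+n+n/2⌋≡n (suc n) rewrite +-suc n n = cong suc (⌊1+n+n/2⌋≡n n)

m∸suc[m∸suc[n]]≡n : ∀ {m n} → n < m → m ∸ suc (m ∸ suc n) ≡ n
m∸suc[m∸suc[n]]≡n {m} {n} n<m = begin
  m ∸ suc (m ∸ suc n)  ≡⟨ cong (m ∸_) (+-∸-assoc 1 n<m) ⟨
  m ∸ (m ∸ n)          ≡⟨ m∸[m∸n]≡n (<⇒≤ n<m) ⟩
  n                    ∎
  where open ≡-Reasoning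

zigzag : ℕ → ℕ → ℕ
zigzag N k with parity k
... | 0ℙ = ⌊ k /2⌋
... | 1ℙ = N ∸ suc ⌊ k /2⌋

zigzag-even : ∀ N a → zigzag N (a + a) ≡ a
zigzag-even N a rewrite parity[n+n]≡0ℙ a = sym (n≡⌊n+n/2⌋ a)

zigzag-odd : ∀ N a → zigzag N (suc (a + a)) ≡ N ∸ suc a
zigzag-odd N a rewrite parity[1+n+n]≡1ℙ a | ⌊1+n+n/2⌋≡n a = refl

zigzag-< : ∀ {N k} → k < N → zigzag N k < N
zigzag-< {N} {k} k<N with even-or-odd k
... | inj₁ (a , refl) rewrite zigzag-even N a = ≤-<-trans (m≤m+n a a) k<N
zigzag-< {suc N} k<N | inj₂ (a , refl) rewrite zigzag-odd (suc N) a = s≤s (m∸n≤m N a)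

unzigzag : ℕ → ℕ → ℕ
unzigzag N v with v + v <? N
... | yes _ = v + v
... | no  _ = suc ((N ∸ suc v) + (N ∸ suc v))

unzigzag-< : ∀ {N v} → v < N → unzigzag N v < N
unzigzag-< {N} {v} v<N with v + v <? N
... | yes 2v<N = 2v<N
... | no  2v≮N = begin-strict
  suc (c + c)  <⟨ s≤s (+-monoʳ-< c c<v) ⟩
  suc (c + v)  ≡⟨ +-suc c v ⟨
  c + suc v    ≡⟨ m∸n+n≡m v<N ⟩
  N            ∎
  where
  open ≤-Reasoning
  c : ℕ
  c = N ∸ suc v
  c<v : c < v
  c<v = +-cancelʳ-< (suc v) c v (begin-strict
    c + suc v  ≡⟨ m∸n+n≡m v<N ⟩
    N          ≤⟨ ≮⇒≥ 2v≮N ⟩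
    v + v      <⟨ n<1+n (v + v) ⟩
    suc v + v  ≡⟨ +-comm (suc v) v ⟩
    v + suc v  ∎)

zigzag-unzigzag : ∀ {N v} → v < N → zigzag N (unzigzag N v) ≡ v
zigzag-unzigzag {N} {v} v<N with v + v <? N
... | yes _ = zigzag-even N v
... | no  _ = trans (zigzag-odd N (N ∸ suc v)) (m∸suc[m∸suc[n]]≡n v<N)

-- The image of an odd index lies in the upper half, where unzigzag uses odd indices.
zigzag-odd-large : ∀ {N b} → suc (b + b) < N → N ≤ (N ∸ suc b) + (N ∸ suc b)
zigzag-odd-large {N} {b} 1+2b<N = begin
  N                          ≡⟨ m∸n+n≡m sb≤N ⟨
  (N ∸ suc b) + suc b        ≤⟨ +-monoʳ-≤ (N ∸ suc b) sb≤N∸sb ⟩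
  (N ∸ suc b) + (N ∸ suc b)  ∎
  where
  open ≤-Reasoning
  sb≤N∸sb : suc b ≤ N ∸ suc b
  sb≤N∸sb = m+n≤o⇒m≤o∸n (suc b) (subst (_≤ N) (cong suc (sym (+-suc b b))) 1+2b<N)
  sb≤N : suc b ≤ N
  sb≤N = ≤-trans sb≤N∸sb (m∸n≤m N (suc b))

unzigzag-zigzag : ∀ {N k} → k < N → unzigzag N (zigzag N k) ≡ k
unzigzag-zigzag {N} {k} k<N with even-or-odd k
... | inj₁ (a , refl) rewrite zigzag-even N a with a + a <? N
...   | yes _    = refl
...   | no  2a≮N = contradiction k<N 2a≮N
unzigzag-zigzag {N} {k} k<N | inj₂ (b , refl) rewrite zigzag-odd N b
  with (N ∸ suc b) + (N ∸ suc b) <? N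
...   | yes 2v<N = contradiction (zigzag-odd-large k<N) (<⇒≱ 2v<N)
...   | no  _    = cong (λ c → suc (c + c)) (m∸suc[m∸suc[n]]≡n (≤-<-trans (m≤m+n b b) (<⇒≤ k<N)))

zigzag-adjacent : ∀ {N k} → suc k < N →
                  suc (zigzag N k + zigzag N (suc k)) ≡ N ⊎ zigzag N k + zigzag N (suc k) ≡ N
zigzag-adjacent {N} {k} 1+k<N with even-or-odd k
... | inj₁ (a , refl) rewrite zigzag-even N a | zigzag-odd N a =
  inj₁ (m+[n∸m]≡n (m+n≤o⇒m≤o (suc a) (<⇒≤ 1+k<N)))
... | inj₂ (a , refl) rewrite zigzag-odd N a
                            | cong (zigzag N) (cong suc (sym (+-suc a a)))
                            | zigzag-even N (suc a) =
  inj₂ (m∸n+n≡m (m+n≤o⇒m≤o (suc a) (<⇒≤ (<⇒≤ 1+k<N))))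

zigzagFin : ∀ {N} → Fin N → Fin N
zigzagFin i = fromℕ< (zigzag-< (toℕ<n i))

unzigzagFin : ∀ {N} → Fin N → Fin N
unzigzagFin i = fromℕ< (unzigzag-< (toℕ<n i))

toℕ-zigzagFin : ∀ {N} (i : Fin N) → toℕ (zigzagFin i) ≡ zigzag N (toℕ i)
toℕ-zigzagFin i = toℕ-fromℕ< (zigzag-< (toℕ<n i))

zigzagFin-bijective : ∀ {N} → Bijective _≡_ _≡_ (zigzagFin {N})
zigzagFin-bijective {N} = inverseᵇ⇒bijective
  ( strictlyInverseˡ⇒inverseˡ {f⁻¹ = unzigzagFin} zigzagFin zigzag∘unzigzag
  , strictlyInverseʳ⇒inverseʳ {f⁻¹ = unzigzagFin} zigzagFin unzigzag∘zigzag )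
  where
  zigzag∘unzigzag : ∀ i → zigzagFin (unzigzagFin i) ≡ i
  zigzag∘unzigzag i = toℕ-injective (begin
    toℕ (zigzagFin (unzigzagFin i))  ≡⟨ toℕ-zigzagFin (unzigzagFin i) ⟩
    zigzag N (toℕ (unzigzagFin i))   ≡⟨ cong (zigzag N) (toℕ-fromℕ< (unzigzag-< (toℕ<n i))) ⟩
    zigzag N (unzigzag N (toℕ i))    ≡⟨ zigzag-unzigzag (toℕ<n i) ⟩
    toℕ i                            ∎)
    where open ≡-Reasoning
  unzigzag∘zigzag : ∀ i → unzigzagFin (zigzagFin i) ≡ i
  unzigzag∘zigzag i = toℕ-injective (begin
    toℕ (unzigzagFin (zigzagFin i))  ≡⟨ toℕ-fromℕ< (unzigzag-< (toℕ<n (zigzagFin i))) ⟩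
    unzigzag N (toℕ (zigzagFin i))   ≡⟨ cong (unzigzag N) (toℕ-zigzagFin i) ⟩
    unzigzag N (zigzag N (toℕ i))    ≡⟨ unzigzag-zigzag (toℕ<n i) ⟩
    toℕ i                            ∎)
    where open ≡-Reasoning

module _ {A : Set} (_≟_ : DecidableEquality A) where

  Unique⇒length≤ : ∀ {xs ys : List A} → Unique xs → (∀ {x} → x ∈ xs → x ∈ ys) → length xs ≤ length ys
  Unique⇒length≤ {[]}     _          _  = z≤n
  Unique⇒length≤ {x ∷ xs} {ys} (x∉xs ∷ uxs) xs⊆ys = begin
    suc (length xs)               ≤⟨ s≤s (Unique⇒length≤ uxs xs⊆ys∖x) ⟩
    suc (length (filter ≢x? ys))  ≤⟨ filter-notAll ≢x? ys (≡x-in (xs⊆ys (here refl))) ⟩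
    length ys                     ∎
    where
    open ≤-Reasoning
    ≢x? : ∀ y → Dec (¬ y ≡ x)
    ≢x? y = ¬? (y ≟ x)
    xs⊆ys∖x : ∀ {z} → z ∈ xs → z ∈ filter ≢x? ys
    xs⊆ys∖x z∈xs = ∈-filter⁺ ≢x? (xs⊆ys (there z∈xs)) (λ z≡x → lookup x∉xs z∈xs (sym z≡x))
    ≡x-in : ∀ {zs} → x ∈ zs → Any (λ y → ¬ ¬ y ≡ x) zs
    ≡x-in (here x≡z)   = here (λ z≢x → z≢x (sym x≡z))
    ≡x-in (there x∈zs) = there (≡x-in x∈zs)

module _ (G : Graph) (f : EdgeLabeling G) where

  private
    colors : List ℕ
    colors = map (weight G f) (allFin (V G))

    weight∈colors : ∀ u → weight G f u ∈ colors
    weight∈colors u = ∈-map⁺ (weight G f) (∈-allFin u)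

  3≤numColors : ∀ u v w → weight G f u < weight G f v → weight G f v < weight G f w → 3 ≤ numColors G f
  3≤numColors u v w u<v v<w = Unique⇒length≤ ℕ._≟_ distinct ⊆colors
    where
    distinct : Unique (weight G f u ∷ weight G f v ∷ weight G f w ∷ [])
    distinct = (<⇒≢ u<v ∷ <⇒≢ (<-trans u<v v<w) ∷ []) ∷ (<⇒≢ v<w ∷ []) ∷ [] ∷ []
    ⊆colors : ∀ {c} → c ∈ weight G f u ∷ weight G f v ∷ weight G f w ∷ [] → c ∈ deduplicate ℕ._≟_ colors
    ⊆colors (here refl)                 = ∈-deduplicate⁺ ℕ._≟_ (weight∈colors u)
    ⊆colors (there (here refl))         = ∈-deduplicate⁺ ℕ._≟_ (weight∈colors v)
    ⊆colors (there (there (here refl))) = ∈-deduplicate⁺ ℕ._≟_ (weight∈colors w)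

  numColors≤length : (cs : List ℕ) → (∀ u → weight G f u ∈ cs) → numColors G f ≤ length cs
  numColors≤length cs weight∈cs = Unique⇒length≤ ℕ._≟_ (deduplicate-! ℕ._≟_ colors) ⊆cs
    where
    ⊆cs : ∀ {c} → c ∈ deduplicate ℕ._≟_ colors → c ∈ cs
    ⊆cs c∈ with ∈-map⁻ (weight G f) (∈-deduplicate⁻ ℕ._≟_ colors c∈)
    ... | u , _ , refl = weight∈cs u

-- Vertex weights as sums over fibres of the endpoint maps

sum-map-+ : ∀ {A : Set} (f g : A → ℕ) xs → sum (map (λ x → f x + g x) xs) ≡ sum (map f xs) + sum (map g xs)
sum-map-+ f g []       = refl
sum-map-+ f g (x ∷ xs) = begin
  (f x + g x) + sum (map (λ x → f x + g x) xs)     ≡⟨ cong ((f x + g x) +_) (sum-map-+ f g xs) ⟩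
  (f x + g x) + (sum (map f xs) + sum (map g xs))  ≡⟨ interchange (f x) (g x) _ _ ⟩
  (f x + sum (map f xs)) + (g x + sum (map g xs))  ∎
  where open ≡-Reasoning

map-allFin-suc : ∀ {A : Set} {n} (f : Fin (suc n) → A) → map f (allFin (suc n)) ≡ f zero ∷ map (f ∘ suc) (allFin n)
map-allFin-suc f = cong (f zero ∷_) (trans (map-tabulate suc f) (sym (map-tabulate id (f ∘ suc))))

sum-allFin-≡0 : ∀ {n} (f : Fin n → ℕ) → (∀ i → f i ≡ 0) → sum (map f (allFin n)) ≡ 0
sum-allFin-≡0 {zero}  f f≡0 = refl
sum-allFin-≡0 {suc n} f f≡0 = begin
  sum (map f (allFin (suc n)))             ≡⟨ cong sum (map-allFin-suc f) ⟩
  f zero + sum (map (f ∘ suc) (allFin n))  ≡⟨ cong₂ _+_ (f≡0 zero) (sum-allFin-≡0 (f ∘ suc) (f≡0 ∘ suc)) ⟩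
  0                                        ∎
  where open ≡-Reasoning

sum-allFin-single : ∀ {n} (f : Fin n → ℕ) i → (∀ j → j ≢ i → f j ≡ 0) → sum (map f (allFin n)) ≡ f i
sum-allFin-single {suc n} f zero f≡0 = begin
  sum (map f (allFin (suc n)))             ≡⟨ cong sum (map-allFin-suc f) ⟩
  f zero + sum (map (f ∘ suc) (allFin n))  ≡⟨ cong (f zero +_) (sum-allFin-≡0 (f ∘ suc) (λ j → f≡0 (suc j) λ ())) ⟩
  f zero + 0                               ≡⟨ +-identityʳ (f zero) ⟩
  f zero                                   ∎
  where open ≡-Reasoning
sum-allFin-single {suc n} f (suc i) f≡0 = begin
  sum (map f (allFin (suc n)))             ≡⟨ cong sum (map-allFin-suc f) ⟩
  f zero + sum (map (f ∘ suc) (allFin n))  ≡⟨ cong₂ _+_ (f≡0 zero λ ()) (sum-allFin-single (f ∘ suc) i f∘suc≡0) ⟩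
  f (suc i)                                ∎
  where
  open ≡-Reasoning
  f∘suc≡0 : ∀ j → j ≢ i → f (suc j) ≡ 0
  f∘suc≡0 j j≢i = f≡0 (suc j) (j≢i ∘ suc-injectiveᶠ)

fibreSum : ∀ {n k} → (Fin n → Fin k) → (Fin n → ℕ) → Fin k → ℕ
fibreSum {n} p l u = sum (map (λ e → if ⌊ p e Fin.≟ u ⌋ then l e else 0) (allFin n))

fibreSum-injective : ∀ {n k} {p : Fin n → Fin k} (l : Fin n → ℕ) → Injective _≡_ _≡_ p →
                     ∀ {e u} → p e ≡ u → fibreSum p l u ≡ l e
fibreSum-injective {p = p} l p-inj {e} refl = trans (sum-allFin-single _ e off-e) at-e
  where
  off-e : ∀ d → d ≢ e → (if ⌊ p d Fin.≟ p e ⌋ then l d else 0) ≡ 0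
  off-e d d≢e with p d Fin.≟ p e
  ... | yes pd≡pe = contradiction (p-inj pd≡pe) d≢e
  ... | no  _     = refl
  at-e : (if ⌊ p e Fin.≟ p e ⌋ then l e else 0) ≡ l e
  at-e with p e Fin.≟ p e
  ... | yes _     = refl
  ... | no  pe≢pe = contradiction refl pe≢pe

fibreSum-empty : ∀ {n k} {p : Fin n → Fin k} (l : Fin n → ℕ) {u} → (∀ e → p e ≢ u) → fibreSum p l u ≡ 0
fibreSum-empty {p = p} l {u} p≢u = sum-allFin-≡0 _ off-u
  where
  off-u : ∀ e → (if ⌊ p e Fin.≟ u ⌋ then l e else 0) ≡ 0
  off-u e with p e Fin.≟ u
  ... | yes pe≡u = contradiction pe≡u (p≢u e)
  ... | no  _    = refl

tail head : (G : Graph) → Fin (E G) → Fin (V G)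
tail G e = proj₁ (ends G e)
head G e = proj₂ (ends G e)

Loopless : Graph → Set
Loopless G = ∀ e → tail G e ≢ head G e

weight≡fibreSum-head+tail : ∀ {G} → Loopless G → (f : EdgeLabeling G) → ∀ u →
  weight G f u ≡ fibreSum (head G) (label {G} f) u + fibreSum (tail G) (label {G} f) u
weight≡fibreSum-head+tail {G} loopless f u = trans (cong sum (map-cong split (allFin (E G)))) (sum-map-+ _ _ (allFin (E G)))
  where
  l : Fin (E G) → ℕ
  l = label {G} f
  split : ∀ e → (if incident G u e then l e else 0)
              ≡ (if ⌊ head G e Fin.≟ u ⌋ then l e else 0) + (if ⌊ tail G e Fin.≟ u ⌋ then l e else 0)
  split e with tail G e Fin.≟ u | head G e Fin.≟ u
  ... | yes t≡u | yes h≡u = contradiction (trans t≡u (sym h≡u)) (loopless e)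
  ... | yes _   | no  _   = refl
  ... | no  _   | yes _   = sym (+-identityʳ (l e))
  ... | no  _   | no  _   = refl

label-injective : ∀ {G} (f : EdgeLabeling G) → Injective _≡_ _≡_ (label {G} f)
label-injective f eq = proj₁ (bij f) (toℕ-injective (suc-injective eq))

module rP-Structure {r m : ℕ} where

  private
    G : Graph
    G = rP r (suc m)
    copy : Fin (r * m) → Fin r
    copy e = proj₁ (remQuot {r} m e)
    pos : Fin (r * m) → Fin m
    pos e = proj₂ (remQuot {r} m e)
    remQuot-injective : ∀ {a b} → copy a ≡ copy b → pos a ≡ pos b → a ≡ b
    remQuot-injective {a} {b} copy≡ pos≡ =
      trans (sym (combine-remQuot {r} m a)) (trans (cong₂ combine copy≡ pos≡) (combine-remQuot {r} m b))

  ends-rP : ∀ i j → ends G (combine i j) ≡ (combine i (inject₁ j) , combine i (suc j))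
  ends-rP i j = cong (λ (i , j) → combine i (inject₁ j) , combine i (suc j)) (remQuot-combine {r} {m} i j)

  rP-loopless : Loopless G
  rP-loopless e tail≡head = inject₁≢suc (combine-injectiveʳ (copy e) (inject₁ (pos e)) (copy e) (suc (pos e)) tail≡head)
    where
    inject₁≢suc : ∀ {n} {j : Fin n} → inject₁ j ≢ suc j
    inject₁≢suc {j = j} eq = 1+n≢n (trans (cong toℕ (sym eq)) (toℕ-inject₁ j))

  tail-rP-injective : Injective _≡_ _≡_ (tail G)
  tail-rP-injective {a} {b} eq with combine-injective (copy a) (inject₁ (pos a)) (copy b) (inject₁ (pos b)) eq
  ... | copy≡ , pos≡ = remQuot-injective copy≡ (inject₁-injective pos≡)

  head-rP-injective : Injective _≡_ _≡_ (head G)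
  head-rP-injective {a} {b} eq with combine-injective (copy a) (suc (pos a)) (copy b) (suc (pos b)) eq
  ... | copy≡ , pos≡ = remQuot-injective copy≡ (suc-injectiveᶠ pos≡)

  module _ (f : EdgeLabeling G) where

    inLabel outLabel : Fin (V G) → ℕ
    inLabel  = fibreSum (head G) (label {G} f)
    outLabel = fibreSum (tail G) (label {G} f)

    inLabel-zero : ∀ i → inLabel (combine i zero) ≡ 0
    inLabel-zero i = fibreSum-empty (label {G} f) λ e head≡ →
      zero≢suc (sym (combine-injectiveʳ (copy e) (suc (pos e)) i zero head≡))

    inLabel-suc : ∀ i j → inLabel (combine i (suc j)) ≡ label {G} f (combine i j)
    inLabel-suc i j = fibreSum-injective (label {G} f) head-rP-injective (cong proj₂ (ends-rP i j))

    outLabel-inject₁ : ∀ i j → outLabel (combine i (inject₁ j)) ≡ label {G} f (combine i j)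
    outLabel-inject₁ i j = fibreSum-injective (label {G} f) tail-rP-injective (cong proj₁ (ends-rP i j))

    outLabel-fromℕ : ∀ i → outLabel (combine i (fromℕ m)) ≡ 0
    outLabel-fromℕ i = fibreSum-empty (label {G} f) λ e tail≡ →
      fromℕ≢inject₁ (sym (combine-injectiveʳ (copy e) (inject₁ (pos e)) i (fromℕ m) tail≡))

    weight-inject₁ : ∀ i j → weight G f (combine i (inject₁ j)) ≡ inLabel (combine i (inject₁ j)) + label {G} f (combine i j)
    weight-inject₁ i j = trans (weight≡fibreSum-head+tail rP-loopless f _) (cong (inLabel _ +_) (outLabel-inject₁ i j))

    weight-suc : ∀ i j → weight G f (combine i (suc j)) ≡ label {G} f (combine i j) + outLabel (combine i (suc j))
    weight-suc i j = trans (weight≡fibreSum-head+tail rP-loopless f _) (cong (_+ outLabel _) (inLabel-suc i j))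

-- Paths with at least three vertices

module _ {r k : ℕ} where

  private
    m : ℕ
    m = suc (suc k)
    G : Graph
    G = rP r (suc m)

  open rP-Structure {r} {m}

  module _ (f : EdgeLabeling G) where

    private
      l : Fin (E G) → ℕ
      l = label {G} f
      w : Fin (V G) → ℕ
      w = weight G f

    weight-start : ∀ i → w (combine i zero) ≡ l (combine i zero)
    weight-start i = trans (weight-inject₁ f i zero) (cong (_+ l (combine i zero)) (inLabel-zero f i))

    weight-end : ∀ i → w (combine i (fromℕ m)) ≡ l (combine i (fromℕ (suc k)))
    weight-end i = trans (weight-suc f i (fromℕ (suc k))) (trans (cong (l _ +_) (outLabel-fromℕ f i)) (+-identityʳ _))

    weight-inner : ∀ i (t : Fin (suc k)) →
                   w (combine i (suc (inject₁ t))) ≡ l (combine i (inject₁ t)) + l (combine i (suc t))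
    weight-inner i t = trans (weight-suc f i (inject₁ t)) (cong (l _ +_) (outLabel-inject₁ f i (suc t)))

    inLabel≢outLabel : ∀ i (j : Fin m) → inLabel f (combine i (inject₁ j)) ≢ outLabel f (combine i (suc j))
    inLabel≢outLabel i zero eq = 0≢1+n (trans (sym (inLabel-zero f i)) (trans eq (outLabel-inject₁ f i (suc zero))))
    inLabel≢outLabel i (suc j) eq with view j
    ... | ‵fromℕ     = 1+n≢0 (trans (sym (inLabel-suc f i (inject₁ (fromℕ k)))) (trans eq (outLabel-fromℕ f i)))
    ... | ‵inject₁ t = m≢1+n+m (toℕ t) {1} (begin
      toℕ t                      ≡⟨ toℕ-inject₁ t ⟨
      toℕ (inject₁ t)            ≡⟨ toℕ-inject₁ (inject₁ t) ⟨
      toℕ (inject₁ (inject₁ t))  ≡⟨ cong toℕ (combine-injectiveʳ i _ i _ (label-injective f labels≡)) ⟩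
      suc (suc (toℕ t))          ∎)
      where
      open ≡-Reasoning
      labels≡ : l (combine i (inject₁ (inject₁ t))) ≡ l (combine i (suc (suc t)))
      labels≡ = trans (sym (inLabel-suc f i (inject₁ (inject₁ t)))) (trans eq (outLabel-inject₁ f i (suc (suc t))))

    rP-localAntimagic : IsLocalAntimagic G f
    rP-localAntimagic e weights≡ = inLabel≢outLabel i j (+-cancelʳ-≡ (l (combine i j)) _ _ (begin
      inLabel f (combine i (inject₁ j)) + l (combine i j)  ≡⟨ weight-inject₁ f i j ⟨
      w (combine i (inject₁ j))                            ≡⟨ weights≡ ⟩
      w (combine i (suc j))                                ≡⟨ weight-suc f i j ⟩
      l (combine i j) + outLabel f (combine i (suc j))     ≡⟨ +-comm (l (combine i j)) _ ⟩
      outLabel f (combine i (suc j)) + l (combine i j)     ∎))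
      where
      open ≡-Reasoning
      i : Fin r
      i = proj₁ (remQuot {r} m e)
      j : Fin m
      j = proj₂ (remQuot {r} m e)

    module _ (i : Fin r) where

      private
        start end afterStart beforeEnd : Fin (V G)
        start      = combine i zero
        end        = combine i (fromℕ m)
        afterStart = combine i (suc zero)
        beforeEnd  = combine i (suc (inject₁ (fromℕ k)))

        start≢end : w start ≢ w end
        start≢end eq with combine-injectiveʳ i zero i (fromℕ (suc k))
                            (label-injective f (trans (sym (weight-start i)) (trans eq (weight-end i))))
        ... | ()

        start<afterStart : w start < w afterStart
        start<afterStart = subst₂ _<_ (sym (weight-start i)) (sym (weight-inner i zero)) (m<m+n _ z<s)

        end<beforeEnd : w end < w beforeEnd
        end<beforeEnd = subst₂ _<_ (sym (weight-end i)) (sym (weight-inner i (fromℕ k))) (m<n+m _ z<s)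

      rP-3≤numColors : 3 ≤ numColors G f
      rP-3≤numColors with <-cmp (w start) (w end)
      ... | tri< start<end _ _ = 3≤numColors G f start end beforeEnd start<end end<beforeEnd
      ... | tri≈ _ start≡end _ = contradiction start≡end start≢end
      ... | tri> _ _ end<start = 3≤numColors G f end start afterStart end<start start<afterStart

  zigzagLabeling : EdgeLabeling G
  zigzagLabeling = record { lab = zigzagFin ; bij = zigzagFin-bijective }

  private
    N : ℕ
    N = r * m
    w : Fin (V G) → ℕ
    w = weight G zigzagLabeling

  zigzagLabeling-weight-inner : ∀ i (t : Fin (suc k)) →
    w (combine i (suc (inject₁ t))) ≡ suc N ⊎ w (combine i (suc (inject₁ t))) ≡ suc (suc N)
  zigzagLabeling-weight-inner i t =
    Sum.map (λ eq → trans weight≡ (cong suc eq)) (λ eq → trans weight≡ (cong (λ s → suc (suc s)) eq))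
            (zigzag-adjacent 1+q<N)
    where
    q : ℕ
    q = m * toℕ i + toℕ t
    toℕ-left : toℕ (combine {r} {m} i (inject₁ t)) ≡ q
    toℕ-left = trans (toℕ-combine i (inject₁ t)) (cong (m * toℕ i +_) (toℕ-inject₁ t))
    toℕ-right : toℕ (combine {r} {m} i (suc t)) ≡ suc q
    toℕ-right = trans (toℕ-combine i (suc t)) (+-suc (m * toℕ i) (toℕ t))
    1+q<N : suc q < N
    1+q<N = subst (_< N) toℕ-right (toℕ<n (combine i (suc t)))
    weight≡ : w (combine i (suc (inject₁ t))) ≡ suc (suc (zigzag N q + zigzag N (suc q)))
    weight≡ = begin
      w (combine i (suc (inject₁ t)))  ≡⟨ weight-inner zigzagLabeling i t ⟩
      suc (toℕ (zigzagFin (combine i (inject₁ t)))) + suc (toℕ (zigzagFin (combine i (suc t))))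
        ≡⟨ cong₂ (λ a b → suc a + suc b) (trans (toℕ-zigzagFin (combine i (inject₁ t))) (cong (zigzag N) toℕ-left))
                                             (trans (toℕ-zigzagFin (combine i (suc t))) (cong (zigzag N) toℕ-right)) ⟩
      suc (zigzag N q) + suc (zigzag N (suc q))  ≡⟨ cong suc (+-suc (zigzag N q) (zigzag N (suc q))) ⟩
      suc (suc (zigzag N q + zigzag N (suc q)))  ∎
      where open ≡-Reasoning

  zigzagLabeling-numColors≤ : numColors G zigzagLabeling ≤ 2 * r + 2
  zigzagLabeling-numColors≤ = begin
    numColors G zigzagLabeling  ≤⟨ numColors≤length G zigzagLabeling colors weight∈colors ⟩
    length colors               ≡⟨ length-colors ⟩
    2 * r + 2                   ∎
    where
    open ≤-Reasoning
    startWeights endWeights : List ℕ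
    startWeights = map (λ i → w (combine i zero)) (allFin r)
    endWeights   = map (λ i → w (combine i (fromℕ m))) (allFin r)

    colors : List ℕ
    colors = suc N ∷ suc (suc N) ∷ startWeights ++ endWeights

    length-colors : length colors ≡ 2 * r + 2
    length-colors = begin-equality
      2 + length (startWeights ++ endWeights)        ≡⟨ cong (2 +_) (length-++ startWeights) ⟩
      2 + (length startWeights + length endWeights)  ≡⟨ cong₂ (λ a b → 2 + (a + b)) (length-allFin-map _) (length-allFin-map _) ⟩
      2 + (r + r)                                    ≡⟨ cong (λ b → 2 + (r + b)) (+-identityʳ r) ⟨
      2 + 2 * r                                      ≡⟨ +-comm 2 (2 * r) ⟩
      2 * r + 2                                      ∎
      where
      length-allFin-map : (g : Fin r → ℕ) → length (map g (allFin r)) ≡ r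
      length-allFin-map g = trans (length-map g (allFin r)) (length-tabulate id)

    weight-combine∈colors : ∀ (i : Fin r) (j : Fin (suc m)) → w (combine i j) ∈ colors
    weight-combine∈colors i zero = there (there (∈-++⁺ˡ (∈-map⁺ (λ i → w (combine i zero)) (∈-allFin i))))
    weight-combine∈colors i (suc j) with view j
    ... | ‵fromℕ     = there (there (∈-++⁺ʳ startWeights (∈-map⁺ (λ i → w (combine i (fromℕ m))) (∈-allFin i))))
    ... | ‵inject₁ t with zigzagLabeling-weight-inner i t
    ...   | inj₁ w≡ = here w≡
    ...   | inj₂ w≡ = there (here w≡)

    weight∈colors : ∀ u → w u ∈ colors
    weight∈colors u = subst (λ u → w u ∈ colors) (combine-remQuot {r} (suc m) u) (weight-combine∈colors _ _)

mainTheorem1 : (r n : ℕ) → 1 ≤ r → 3 ≤ n →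
    Σ (EdgeLabeling (rP r n)) (λ f → IsLocalAntimagic (rP r n) f × numColors (rP r n) f ≤ 2 * r + 2)
    × ((f : EdgeLabeling (rP r n)) → IsLocalAntimagic (rP r n) f → 3 ≤ numColors (rP r n) f)
mainTheorem1 (suc r) (suc (suc (suc k))) (s≤s z≤n) (s≤s (s≤s (s≤s z≤n))) =
  (zigzagLabeling , rP-localAntimagic zigzagLabeling , zigzagLabeling-numColors≤ {suc r} {k}) ,
  λ f _ → rP-3≤numColors f zero
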